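{- If $G$ is a triangle-free graph with minimum degree $\delta(G)\ge 3$, then ${\rm gp}_{\rm d}(G)=0$.
   Context: For $S\subseteq V(G)$, two vertices $u,v$ are $S$-positionable if every shortest $u,v$-path $P$ satisfies $V(P)\cap S\subseteq\{u,v\}$. $S$ is a general position set if every two vertices of $S$ are $S$-positionable, and a dual general position set if it is a general position set and every two vertices of $V(G)\setminus S$ are $S$-positionable. ${\rm gp}_{\rm d}(G)$ is the maximum size of a dual general position set of $G$. -}

module Defs where

open import Data.Nat using (ℕ; zero; suc; _≤_)
open import Data.Fin using (Fin)
open import Data.Fin.Subset using (Subset; _∈_; _∉_; ∣_∣)
open import Data.Bool using (Bool; true; false; T)
open import Data.Vec using (tabulate)
open import Data.List using (List; []; _∷_)
import Data.List.Membership.Propositional as LM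
open import Data.Product using (Σ; ∃; _×_)
open import Data.Sum using (_⊎_)
open import Relation.Nullary using (¬_)
open import Relation.Binary.PropositionalEquality using (_≡_)

record Graph (n : ℕ) : Set where
  field
    adj   : Fin n → Fin n → Bool
    symm  : ∀ u v → adj u v ≡ adj v u
    irrfl : ∀ v → adj v v ≡ false

module _ {n : ℕ} (G : Graph n) where
  open Graph G

  Adj : Fin n → Fin n → Set
  Adj u v = T (adj u v)

  nbhd : Fin n → Subset n
  nbhd v = tabulate (adj v)

  degree : Fin n → ℕ
  degree v = ∣ nbhd v ∣

  MinDegreeAtLeast : ℕ → Set
  MinDegreeAtLeast d = ∀ v → d ≤ degree v

  TriangleFree : Set
  TriangleFree = ∀ u v w → ¬ (Adj u v × Adj v w × Adj u w)

  data Walk : Fin n → Fin n → ℕ → Set where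
    here : ∀ v → Walk v v zero
    step : ∀ {u w v k} → Adj u w → Walk w v k → Walk u v (suc k)

  verts : ∀ {u v k} → Walk u v k → List (Fin n)
  verts (here v) = v ∷ []
  verts (step {u = u} _ p) = u ∷ verts p

  Connected : Set
  Connected = ∀ u v → ∃ λ k → Walk u v k

  -- a shortest u,v-path: a u,v-walk of minimum length (such a walk is a path)
  IsShortest : ∀ {u v k} → Walk u v k → Set
  IsShortest {u} {v} {k} _ = ∀ {k'} → Walk u v k' → k ≤ k'

  Positionable : Subset n → Fin n → Fin n → Set
  Positionable S u v =
    ∀ {k} (P : Walk u v k) → IsShortest P →
      ∀ x → x LM.∈ verts P → x ∈ S → (x ≡ u ⊎ x ≡ v)

  IsGeneralPosition : Subset n → Set
  IsGeneralPosition S = ∀ u v → u ∈ S → v ∈ S → Positionable S u v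

  IsDualGeneralPosition : Subset n → Set
  IsDualGeneralPosition S =
    IsGeneralPosition S × (∀ u v → u ∉ S → v ∉ S → Positionable S u v)

  GpdEquals : ℕ → Set
  GpdEquals k =
    (Σ (Subset n) λ S → IsDualGeneralPosition S × ∣ S ∣ ≡ k)
    × (∀ S → IsDualGeneralPosition S → ∣ S ∣ ≤ k)

{-# OPTIONS --safe #-}
module Submission where

-- Let S be a dual general position set and suppose v ∈ S. Of the at least
-- three neighbours of v, two distinct ones a, b lie on the same side of S.
-- As G is triangle-free, a and b are not adjacent, so a v b is a shortest
-- a,b-path; its inner vertex v lies in S, so a and b are not S-positionable,
-- whereas duality demands they are. Hence S = ∅, and ∅ is trivially a dual
-- general position set.

open import Defs
open import Data.Nat using (ℕ; zero; suc; _≤_; _+_; z≤n; s≤s)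
open import Data.Nat.Properties using (≤-trans; ≤-reflexive; n≤1+n; +-suc)
open import Data.Fin using (zero; suc)
open import Data.Fin.Subset using (Subset; _∈_; ∣_∣; _∩_; ∁; ⊥; inside; outside; Nonempty; Empty)
open import Data.Fin.Subset.Properties using (∉⊥; ∣⊥∣≡0; Empty-unique; x∈p∩q⁻; x∈∁p⇒x∉p)
open import Data.Bool using (T)
open import Data.Bool.Properties using (T-≡)
open import Data.Vec using ([]; _∷_; here; there)
open import Data.Vec.Properties using ([]=⇒lookup; lookup∘tabulate)
import Data.List.Relation.Unary.Any as List
open import Data.Product using (∃₂; _×_; _,_)
open import Data.Sum using (_⊎_; inj₁; inj₂)
open import Data.Empty using (⊥-elim)
open import Function.Bundles using (Equivalence)
open import Relation.Nullary using (¬_)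
open import Relation.Binary.PropositionalEquality using (_≡_; _≢_; refl; sym; trans; cong; subst; module ≡-Reasoning)

3≤m+n⇒2≤m⊎2≤n : ∀ m {n} → 3 ≤ m + n → 2 ≤ m ⊎ 2 ≤ n
3≤m+n⇒2≤m⊎2≤n zero          3≤n       = inj₂ (≤-trans (n≤1+n 2) 3≤n)
3≤m+n⇒2≤m⊎2≤n (suc zero)    (s≤s 2≤n) = inj₂ 2≤n
3≤m+n⇒2≤m⊎2≤n (suc (suc m)) _         = inj₁ (s≤s (s≤s z≤n))

DistinctPairIn : ∀ {n} → Subset n → Set
DistinctPairIn p = ∃₂ λ a b → a ≢ b × a ∈ p × b ∈ p

∣p∣≡∣p∩q∣+∣p∩∁q∣ : ∀ {n} (p q : Subset n) → ∣ p ∣ ≡ ∣ p ∩ q ∣ + ∣ p ∩ ∁ q ∣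
∣p∣≡∣p∩q∣+∣p∩∁q∣ []            []            = refl
∣p∣≡∣p∩q∣+∣p∩∁q∣ (outside ∷ p) (_ ∷ q)       = ∣p∣≡∣p∩q∣+∣p∩∁q∣ p q
∣p∣≡∣p∩q∣+∣p∩∁q∣ (inside ∷ p)  (inside ∷ q)  = cong suc (∣p∣≡∣p∩q∣+∣p∩∁q∣ p q)
∣p∣≡∣p∩q∣+∣p∩∁q∣ (inside ∷ p)  (outside ∷ q) =
  trans (cong suc (∣p∣≡∣p∩q∣+∣p∩∁q∣ p q)) (sym (+-suc ∣ p ∩ q ∣ ∣ p ∩ ∁ q ∣))

1≤∣p∣⇒Nonempty : ∀ {n} (p : Subset n) → 1 ≤ ∣ p ∣ → Nonempty p
1≤∣p∣⇒Nonempty (outside ∷ p) 1≤∣p∣ with 1≤∣p∣⇒Nonempty p 1≤∣p∣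
... | a , a∈p = suc a , there a∈p
1≤∣p∣⇒Nonempty (inside ∷ p)  _     = zero , here

2≤∣p∣⇒DistinctPairIn : ∀ {n} (p : Subset n) → 2 ≤ ∣ p ∣ → DistinctPairIn p
2≤∣p∣⇒DistinctPairIn (outside ∷ p) 2≤∣p∣ with 2≤∣p∣⇒DistinctPairIn p 2≤∣p∣
... | a , b , a≢b , a∈p , b∈p = suc a , suc b , (λ { refl → a≢b refl }) , there a∈p , there b∈p
2≤∣p∣⇒DistinctPairIn (inside ∷ p) (s≤s 1≤∣p∣) with 1≤∣p∣⇒Nonempty p 1≤∣p∣
... | b , b∈p = zero , suc b , (λ ()) , here , there b∈p

3≤∣p∣⇒DistinctPairIn∩⊎∩∁ : ∀ {n} (p q : Subset n) → 3 ≤ ∣ p ∣ →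
                           DistinctPairIn (p ∩ q) ⊎ DistinctPairIn (p ∩ ∁ q)
3≤∣p∣⇒DistinctPairIn∩⊎∩∁ p q 3≤∣p∣
  with 3≤m+n⇒2≤m⊎2≤n ∣ p ∩ q ∣ (subst (3 ≤_) (∣p∣≡∣p∩q∣+∣p∩∁q∣ p q) 3≤∣p∣)
... | inj₁ 2≤∣p∩q∣  = inj₁ (2≤∣p∣⇒DistinctPairIn (p ∩ q) 2≤∣p∩q∣)
... | inj₂ 2≤∣p∩∁q∣ = inj₂ (2≤∣p∣⇒DistinctPairIn (p ∩ ∁ q) 2≤∣p∩∁q∣)

module _ {n : ℕ} (G : Graph n) where
  open Graph G

  Adj-sym : ∀ {u v} → Adj G u v → Adj G v u
  Adj-sym {u} {v} = subst T (symm u v)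

  Adj-irrefl : ∀ {v} → ¬ Adj G v v
  Adj-irrefl {v} = subst T (irrfl v)

  ∈nbhd⇒Adj : ∀ {v x} → x ∈ nbhd G v → Adj G v x
  ∈nbhd⇒Adj {v} {x} x∈N =
    Equivalence.from T-≡ (trans (sym (lookup∘tabulate (adj v) x)) ([]=⇒lookup x∈N))

  walk-length≥2 : ∀ {a b k} → a ≢ b → ¬ Adj G a b → Walk G a b k → 2 ≤ k
  walk-length≥2 a≢b _    (here _)              = ⊥-elim (a≢b refl)
  walk-length≥2 _   ¬a~b (step a~b (here _))   = ⊥-elim (¬a~b a~b)
  walk-length≥2 _   _    (step _ (step _ _))   = s≤s (s≤s z≤n)

  common-neighbour∈S⇒¬Positionable :
    ∀ (S : Subset n) {v a b} → v ∈ S → a ≢ b → ¬ Adj G a b →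
    Adj G v a → Adj G v b → ¬ Positionable G S a b
  common-neighbour∈S⇒¬Positionable S {v} {a} {b} v∈S a≢b ¬a~b v~a v~b pos
    with pos a-v-b (walk-length≥2 a≢b ¬a~b) v (List.there (List.here refl)) v∈S
    where
      a-v-b : Walk G a b 2
      a-v-b = step (Adj-sym v~a) (step v~b (here b))
  ... | inj₁ refl = Adj-irrefl v~a
  ... | inj₂ refl = Adj-irrefl v~b

  ⊥-isDualGeneralPosition : IsDualGeneralPosition G ⊥
  ⊥-isDualGeneralPosition =
    (λ _ _ u∈⊥ _ → ⊥-elim (∉⊥ u∈⊥)) , (λ _ _ _ _ _ _ _ _ x∈⊥ → ⊥-elim (∉⊥ x∈⊥))

  distinct-neighbours⇒¬Positionable :
    TriangleFree G → ∀ (S : Subset n) {v a b} → v ∈ S →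
    a ∈ nbhd G v → b ∈ nbhd G v → a ≢ b → ¬ Positionable G S a b
  distinct-neighbours⇒¬Positionable triangleFree S {v} {a} {b} v∈S a∈N b∈N a≢b =
    common-neighbour∈S⇒¬Positionable S v∈S a≢b
      (λ a~b → triangleFree v _ _ (v~a , a~b , v~b)) v~a v~b
    where
      v~a : Adj G v a
      v~a = ∈nbhd⇒Adj a∈N
      v~b : Adj G v b
      v~b = ∈nbhd⇒Adj b∈N

  dualGeneralPosition⇒Empty : TriangleFree G → MinDegreeAtLeast G 3 →
                              ∀ S → IsDualGeneralPosition G S → Empty S
  dualGeneralPosition⇒Empty triangleFree δ≥3 S (inS , outS) (v , v∈S)
    with 3≤∣p∣⇒DistinctPairIn∩⊎∩∁ (nbhd G v) S (δ≥3 v)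
  ... | inj₁ (a , b , a≢b , a∈N∩S , b∈N∩S) =
    let a∈N , a∈S = x∈p∩q⁻ _ _ a∈N∩S
        b∈N , b∈S = x∈p∩q⁻ _ _ b∈N∩S
    in distinct-neighbours⇒¬Positionable triangleFree S v∈S a∈N b∈N a≢b
         (inS a b a∈S b∈S)
  ... | inj₂ (a , b , a≢b , a∈N∖S , b∈N∖S) =
    let a∈N , a∈∁S = x∈p∩q⁻ _ _ a∈N∖S
        b∈N , b∈∁S = x∈p∩q⁻ _ _ b∈N∖S
    in distinct-neighbours⇒¬Positionable triangleFree S v∈S a∈N b∈N a≢b
         (outS a b (x∈∁p⇒x∉p a∈∁S) (x∈∁p⇒x∉p b∈∁S))

mainTheorem9 : ∀ {n : ℕ} (G : Graph n) → Connected G → TriangleFree G → MinDegreeAtLeast G 3 → GpdEquals G 0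
mainTheorem9 {n} G _ triangleFree δ≥3 =
  (⊥ , ⊥-isDualGeneralPosition G , ∣⊥∣≡0 n) , ∣S∣≤0
  where
    ∣S∣≤0 : ∀ S → IsDualGeneralPosition G S → ∣ S ∣ ≤ 0
    ∣S∣≤0 S isDual = ≤-reflexive (begin
      ∣ S ∣ ≡⟨ cong ∣_∣ (Empty-unique (dualGeneralPosition⇒Empty G triangleFree δ≥3 S isDual)) ⟩
      ∣ ⊥ {n = n} ∣ ≡⟨ ∣⊥∣≡0 n ⟩
      0             ∎)
      where open ≡-Reasoning
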